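{- Let $\mathbb{F}$ be a finite field, $\mathcal{C}_1\subset\mathcal{C}\subseteq\mathbb{F}^n$ linear codes with $\dim\mathcal{C}/\mathcal{C}_1=1$, and $\mathcal{D}=\mathcal{C}^\perp\subset\mathcal{D}_1=\mathcal{C}_1^\perp$. Let $a_1,\ldots,a_w,b_1,\ldots,b_w\in\mathbb{F}^n$ satisfy $a_i\ast b_j\in\mathcal{D}$ for $i+j\leq w$ and $a_i\ast b_j\in\mathcal{D}_1\setminus\mathcal{D}$ for $i+j=w+1$, and fix $x\in\mathcal{D}_1\setminus\mathcal{D}$ such that $a_i\ast b_{w+1-i}\in x+\mathcal{D}$ for $i=1,\ldots,w$. Let $t$ be an integer with $2t<w$ (so $w\le d(\mathcal{C}/\mathcal{C}_1)$). Put $A_i=a_i+\langle a_1,\ldots,a_{i-1}\rangle$ and $B_{w+1-i}=b_{w+1-i}+\langle b_1,\ldots,b_{w-i}\rangle$. For $y\in\mathbb{F}^n$ with $d(y,\mathcal{C})\leq t$ let \[ I=\{1\leq i\leq w:\ \exists\,a_i'\in A_i \text{ with } (a_i'\ast b_j)\cdot y=0 \text{ for } 1\leq j\leq w-i\}, \] \[ I^\ast=\{1\leq j\leq w:\ \exists\,b_j'\in B_{w+1-j} \text{ with } (a_i\ast b_j')\cdot y=0 \text{ for } 1\leq i\leq j-1\}. \] For $i\in I\cap I^\ast$ let $a_i'$, $b_i'$ be vectors witnessing $i\in I$ and $i\in I^\ast$ respectively. Then for every $c\in\mathcal{C}$ with $d(y,c)\leq t$, the equality $x\cdot c=(a_i'\ast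 b_i')\cdot y$ holds for a (strict) majority of the indices $i\in I\cap I^\ast$.
   Context: $\cdot$ is the standard inner product on $\mathbb{F}^n$, $\ast$ the coordinatewise product, $d$ the Hamming distance, $d(y,\mathcal{C})=\min_{c\in\mathcal{C}}d(y,c)$, and $d(\mathcal{C}/\mathcal{C}_1)=\min\{d(c,0):c\in\mathcal{C}\setminus\mathcal{C}_1\}$. Since $x\cdot c$ determines the coset $c+\mathcal{C}_1$, the statement gives a majority-vote procedure recovering the unique coset within distance $t$ of $y$. -}

module Defs where

open import Level using (Level; _⊔_)
open import Data.Nat using (ℕ; zero; suc; _≤_; _∸_)
open import Data.Fin using (Fin; toℕ)
import Data.Fin as Fin
open import Data.Product using (Σ; ∃; ∃-syntax; _×_; _,_)
open import Relation.Nullary using (¬_; Dec; yes; no)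
open import Relation.Binary using (Decidable)
open import Algebra.Bundles using (CommutativeRing)

record FiniteField (c ℓ : Level) : Set (Level.suc (c ⊔ ℓ)) where
  field
    commutativeRing : CommutativeRing c ℓ
  open CommutativeRing commutativeRing public
  field
    _≟_      : Decidable _≈_
    1≉0      : ¬ (1# ≈ 0#)
    inverse  : ∀ x → ¬ (x ≈ 0#) → ∃[ y ] (x * y ≈ 1#)
    size     : ℕ
    enum     : Fin size → Carrier
    enum-onto : ∀ x → ∃[ i ] (enum i ≈ x)

module Codes {c ℓ : Level} (F : FiniteField c ℓ) where
  open FiniteField F

  _≈F_ : Carrier → Carrier → Set ℓ
  _≈F_ = _≈_

  Vec : ℕ → Set c
  Vec n = Fin n → Carrier

  _≈v_ : ∀ {n} → Vec n → Vec n → Set ℓ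
  u ≈v v = ∀ i → u i ≈ v i

  0v : ∀ {n} → Vec n
  0v _ = 0#

  _+v_ : ∀ {n} → Vec n → Vec n → Vec n
  (u +v v) i = u i + v i

  _-v_ : ∀ {n} → Vec n → Vec n → Vec n
  (u -v v) i = u i + (- v i)

  _•_ : ∀ {n} → Carrier → Vec n → Vec n
  (λ₀ • v) i = λ₀ * v i

  _∗_ : ∀ {n} → Vec n → Vec n → Vec n
  (u ∗ v) i = u i * v i

  sumF : ∀ {n} → Vec n → Carrier
  sumF {zero}  f = 0#
  sumF {suc n} f = f Fin.zero + sumF (λ i → f (Fin.suc i))

  _·_ : ∀ {n} → Vec n → Vec n → Carrier
  u · v = sumF (u ∗ v)

  dist : ∀ {n} → Vec n → Vec n → ℕ
  dist {zero}  u v = 0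
  dist {suc n} u v with u Fin.zero ≟ v Fin.zero
  ... | yes _ = dist (λ i → u (Fin.suc i)) (λ i → v (Fin.suc i))
  ... | no  _ = suc (dist (λ i → u (Fin.suc i)) (λ i → v (Fin.suc i)))

  Code : ℕ → Set (Level.suc (c ⊔ ℓ))
  Code n = Vec n → Set (c ⊔ ℓ)

  record IsLinearCode {n} (C : Code n) : Set (c ⊔ ℓ) where
    field
      resp    : ∀ {u v} → u ≈v v → C u → C v
      has-0   : C 0v
      closed+ : ∀ {u v} → C u → C v → C (u +v v)
      closed• : ∀ λ₀ {u} → C u → C (λ₀ • u)

  _⊆C_ : ∀ {n} → Code n → Code n → Set (c ⊔ ℓ)
  C₁ ⊆C C = ∀ v → C₁ v → C v

  -- dim(C / C₁) = 1 (for C₁ ⊆ C): there is g ∈ C ∖ C₁ with C = C₁ + ⟨g⟩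
  QuotientDim1 : ∀ {n} → Code n → Code n → Set (c ⊔ ℓ)
  QuotientDim1 C C₁ =
    ∃[ g ] (C g × ¬ C₁ g × (∀ v → C v → ∃[ λ₀ ] C₁ (v -v (λ₀ • g))))

  Dual : ∀ {n} → Code n → Code n
  Dual C v = ∀ u → C u → (v · u) ≈ 0#

  -- Σ_{k=1}^{m} λ_k a_k  (families indexed 1-based by ℕ)
  spanSum : ∀ {n} → (ℕ → Carrier) → (ℕ → Vec n) → ℕ → Vec n
  spanSum λs a zero    = 0v
  spanSum λs a (suc m) = spanSum λs a m +v (λs (suc m) • a (suc m))

  InShifted : ∀ {n} → (ℕ → Vec n) → ℕ → Vec n → Set (c ⊔ ℓ)
  InShifted a k v = ∃[ λs ] (v ≈v (a k +v spanSum λs a (k ∸ 1)))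

  WitnessI : ∀ {n} → ℕ → (a b : ℕ → Vec n) → Vec n → ℕ → Vec n → Set (c ⊔ ℓ)
  WitnessI w a b y i a' =
    InShifted a i a' × (∀ j → 1 ≤ j → j ≤ w ∸ i → ((a' ∗ b j) · y) ≈ 0#)

  WitnessI* : ∀ {n} → ℕ → (a b : ℕ → Vec n) → Vec n → ℕ → Vec n → Set (c ⊔ ℓ)
  WitnessI* w a b y j b' =
    InShifted b (suc w ∸ j) b' × (∀ i → 1 ≤ i → i ≤ j ∸ 1 → ((a i ∗ b') · y) ≈ 0#)

  InI : ∀ {n} → ℕ → (a b : ℕ → Vec n) → Vec n → ℕ → Set (c ⊔ ℓ)
  InI w a b y i = ∃[ a' ] WitnessI w a b y i a'

  InI* : ∀ {n} → ℕ → (a b : ℕ → Vec n) → Vec n → ℕ → Set (c ⊔ ℓ)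
  InI* w a b y j = ∃[ b' ] WitnessI* w a b y j b'

idx : ∀ {w} → Fin w → ℕ
idx i = suc (toℕ i)

-- Fix c₀ ∈ C with d(y, c₀) ≤ t and put e = y − c₀.  Because a_i ∗ b_j ∈ C^⊥ for i + j ≤ w and
-- a_i ∗ b_{w+1-i} ∈ x + C^⊥, every a′ ∈ A_i and b′ ∈ B_{w+1-i} satisfy (a′ ∗ b′) · c₀ = x · c₀;
-- hence (a′ ∗ b′) · y = x · c₀ as soon as a′ ∗ e = 0 or b′ ∗ e = 0.  Call the index k of a
-- family g independent if no element of g_k + ⟨g_1, …, g_{k-1}⟩ is killed by e.  Then the row
-- a_i is independent whenever i ∉ I or the vote at i ∈ I ∩ I* is wrong, and dually the column
-- b_{w+1-i} is independent whenever i ∉ I* or the vote is wrong.  The products g_k ∗ e at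
-- independent indices are linearly independent and supported on the ≤ t coordinates where y and
-- c₀ differ, so at most t rows and t columns are independent.  Charging each index outside
-- I ∩ I* once and each wrong vote twice gives  w − |I ∩ I*| + 2·#wrong ≤ 2t < w,  i.e. the
-- correct votes form a strict majority.

module Submission where

open import Defs
open import Level using (Level; _⊔_)
open import Function.Base using (_∘_)
open import Data.Nat.Base as ℕ using (ℕ; zero; suc; _∸_; _≤_; _<_; z≤n; s≤s)
import Data.Nat.Properties as ℕₚ
open import Data.Fin.Base using (Fin; toℕ; opposite)
import Data.Fin.Base as Fin
open import Data.Product.Base using (∃-syntax; _×_; _,_; proj₁; proj₂)
open import Relation.Nullary using (¬_)
open import Relation.Binary.PropositionalEquality as ≡ using (_≡_)

module LinearForms {c ℓ : Level} (F : FiniteField c ℓ) where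
  open FiniteField F
  open Codes F
  open import Algebra.Properties.Semiring.Sum semiring
    using (sum; sum-cong-≋; ∑-distrib-+; *-distribˡ-sum)
  open import Algebra.Properties.CommutativeSemigroup *-commutativeSemigroup
    using (x∙yz≈y∙xz; xy∙z≈y∙xz)
  open import Relation.Binary.Reasoning.Setoid setoid

  sumF≡sum : ∀ {n} (f : Vec n) → sumF f ≡ sum f
  sumF≡sum {zero}  f = ≡.refl
  sumF≡sum {suc n} f = ≡.cong (f Fin.zero +_) (sumF≡sum (f ∘ Fin.suc))

  sumF-cong : ∀ {n} {f g : Vec n} → f ≈v g → sumF f ≈ sumF g
  sumF-cong {f = f} {g} f≈g = begin
    sumF f ≡⟨ sumF≡sum f ⟩
    sum f  ≈⟨ sum-cong-≋ f≈g ⟩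
    sum g  ≡⟨ sumF≡sum g ⟨
    sumF g ∎

  sumF-distrib-+ : ∀ {n} (f g : Vec n) → sumF (f +v g) ≈ sumF f + sumF g
  sumF-distrib-+ f g = begin
    sumF (f +v g)   ≡⟨ sumF≡sum (f +v g) ⟩
    sum (f +v g)    ≈⟨ ∑-distrib-+ f g ⟩
    sum f + sum g   ≡⟨ ≡.cong₂ _+_ (sumF≡sum f) (sumF≡sum g) ⟨
    sumF f + sumF g ∎

  *-distribˡ-sumF : ∀ {n} k (f : Vec n) → sumF (k • f) ≈ k * sumF f
  *-distribˡ-sumF k f = begin
    sumF (k • f) ≡⟨ sumF≡sum (k • f) ⟩
    sum (k • f)  ≈⟨ *-distribˡ-sum k f ⟨
    k * sum f    ≡⟨ ≡.cong (k *_) (sumF≡sum f) ⟨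
    k * sumF f   ∎

  record IsLinearForm {n} (φ : Vec n → Carrier) : Set (c ⊔ ℓ) where
    field
      cong        : ∀ {u v} → u ≈v v → φ u ≈ φ v
      additive    : ∀ u v → φ (u +v v) ≈ φ u + φ v
      homogeneous : ∀ k u → φ (k • u) ≈ k * φ u

  IsLinearForm-resp : ∀ {n} {φ ψ : Vec n → Carrier} →
    (∀ u → φ u ≈ ψ u) → IsLinearForm φ → IsLinearForm ψ
  IsLinearForm-resp φ≈ψ L = record
    { cong        = λ u≈v → trans (sym (φ≈ψ _)) (trans (cong u≈v) (φ≈ψ _))
    ; additive    = λ u v → trans (sym (φ≈ψ _)) (trans (additive u v) (+-cong (φ≈ψ u) (φ≈ψ v)))
    ; homogeneous = λ k u → trans (sym (φ≈ψ _)) (trans (homogeneous k u) (*-congˡ (φ≈ψ u)))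
    }
    where open IsLinearForm L

  ·-linearʳ : ∀ {n} (k : Vec n) → IsLinearForm (k ·_)
  ·-linearʳ k = record
    { cong        = λ u≈v → sumF-cong (λ i → *-congˡ (u≈v i))
    ; additive    = λ u v → trans (sumF-cong (λ i → distribˡ (k i) (u i) (v i)))
                                  (sumF-distrib-+ (k ∗ u) (k ∗ v))
    ; homogeneous = λ μ u → trans (sumF-cong (λ i → x∙yz≈y∙xz (k i) μ (u i)))
                                  (*-distribˡ-sumF μ (k ∗ u))
    }

  ·-linearˡ : ∀ {n} (z : Vec n) → IsLinearForm (_· z)
  ·-linearˡ z = IsLinearForm-resp (λ u → sumF-cong (λ i → *-comm (z i) (u i))) (·-linearʳ z)

  ∗·-assocˡ : ∀ {n} (u v z : Vec n) → ((u ∗ v) · z) ≈ (v · (u ∗ z))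
  ∗·-assocˡ u v z = sumF-cong (λ i → xy∙z≈y∙xz (u i) (v i) (z i))

  ∗·-assocʳ : ∀ {n} (u v z : Vec n) → ((u ∗ v) · z) ≈ (u · (v ∗ z))
  ∗·-assocʳ u v z = sumF-cong (λ i → *-assoc (u i) (v i) (z i))

  ∗·-linearˡ : ∀ {n} (v z : Vec n) → IsLinearForm (λ u → (u ∗ v) · z)
  ∗·-linearˡ v z = IsLinearForm-resp
    (λ u → sym (∗·-assocʳ u v z)) (·-linearˡ (v ∗ z))

  ∗·-linearʳ : ∀ {n} (u z : Vec n) → IsLinearForm (λ v → (u ∗ v) · z)
  ∗·-linearʳ u z = IsLinearForm-resp
    (λ v → sym (∗·-assocˡ u v z)) (·-linearˡ (u ∗ z))

  module _ {n} {φ : Vec n → Carrier} (L : IsLinearForm φ) where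
    open IsLinearForm L

    linearForm-0v : φ 0v ≈ 0#
    linearForm-0v = begin
      φ 0v         ≈⟨ cong (λ _ → sym (zeroˡ 0#)) ⟩
      φ (0# • 0v)  ≈⟨ homogeneous 0# 0v ⟩
      0# * φ 0v    ≈⟨ zeroˡ _ ⟩
      0#           ∎

    linearForm-spanSum : ∀ (g : ℕ → Vec n) λs K →
      (∀ m → 1 ≤ m → m ≤ K → φ (g m) ≈ 0#) → φ (spanSum λs g K) ≈ 0#
    linearForm-spanSum g λs zero    φg≈0 = linearForm-0v
    linearForm-spanSum g λs (suc K) φg≈0 = begin
      φ (spanSum λs g K +v (λs (suc K) • g (suc K)))   ≈⟨ additive _ _ ⟩
      φ (spanSum λs g K) + φ (λs (suc K) • g (suc K))  ≈⟨ +-cong IH (homogeneous _ _) ⟩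
      0# + λs (suc K) * φ (g (suc K))                  ≈⟨ +-identityˡ _ ⟩
      λs (suc K) * φ (g (suc K))                       ≈⟨ *-congˡ (φg≈0 (suc K) (s≤s z≤n) ℕₚ.≤-refl) ⟩
      λs (suc K) * 0#                                  ≈⟨ zeroʳ _ ⟩
      0#                                               ∎
      where
      IH : φ (spanSum λs g K) ≈ 0#
      IH = linearForm-spanSum g λs K (λ m 1≤m m≤K → φg≈0 m 1≤m (ℕₚ.m≤n⇒m≤1+n m≤K))

    linearForm-InShifted : ∀ (g : ℕ → Vec n) k {v} →
      (∀ m → 1 ≤ m → m ≤ k ∸ 1 → φ (g m) ≈ 0#) → InShifted g k v → φ v ≈ φ (g k)
    linearForm-InShifted g k {v} φg≈0 (λs , v≈) = begin
      φ v                               ≈⟨ cong v≈ ⟩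
      φ (g k +v spanSum λs g (k ∸ 1))   ≈⟨ additive _ _ ⟩
      φ (g k) + φ (spanSum λs g (k ∸ 1)) ≈⟨ +-congˡ (linearForm-spanSum g λs (k ∸ 1) φg≈0) ⟩
      φ (g k) + 0#                      ≈⟨ +-identityʳ _ ⟩
      φ (g k)                           ∎

    linearForm-constant-on-InShifted : ∀ (g : ℕ → Vec n) k {u v} →
      (∀ m → 1 ≤ m → m ≤ k ∸ 1 → φ (g m) ≈ 0#) → InShifted g k u → InShifted g k v → φ u ≈ φ v
    linearForm-constant-on-InShifted g k φg≈0 u∈ v∈ =
      trans (linearForm-InShifted g k φg≈0 u∈) (sym (linearForm-InShifted g k φg≈0 v∈))

  ·-≈-by-difference : ∀ {n} {u v : Vec n} z → ((u -v v) · z) ≈ 0# → (u · z) ≈ (v · z)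
  ·-≈-by-difference {u = u} {v} z [u-v]·z≈0 = begin
    u · z                      ≈⟨ cong u≈[u-v]+v ⟩
    ((u -v v) +v v) · z        ≈⟨ additive (u -v v) v ⟩
    ((u -v v) · z) + (v · z)   ≈⟨ +-congʳ [u-v]·z≈0 ⟩
    0# + (v · z)               ≈⟨ +-identityˡ _ ⟩
    v · z                      ∎
    where
    open IsLinearForm (·-linearˡ z)
    u≈[u-v]+v : u ≈v ((u -v v) +v v)
    u≈[u-v]+v i = sym (trans (+-assoc _ _ _) (trans (+-congˡ (-‿inverseˡ (v i))) (+-identityʳ (u i))))

module Counting where
  open import Data.Bool.Base using (Bool; true; false; T; not; _∧_; _∨_)
  open import Data.Fin.Subset using (Subset; ∣_∣)
  import Data.Fin.Permutation as Perm
  open import Data.Fin.Properties using (toℕ<n; opposite-prop)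
  open import Data.Vec.Base using ([]; _∷_; lookup; tabulate)
  open import Data.Vec.Properties using (lookup∘tabulate)
  open import Data.Empty using (⊥-elim)
  open import Data.Unit.Base using (tt)
  open import Algebra.Properties.Semiring.Sum ℕₚ.+-*-semiring public using (sum)
  open import Algebra.Properties.Semiring.Sum ℕₚ.+-*-semiring
    using (∑-distrib-+; ∑-permute; *-distribˡ-sum; sum-cong-≗)

  𝟙 : Bool → ℕ
  𝟙 true  = 1
  𝟙 false = 0

  sum-mono-≤ : ∀ {w} {f g : Fin w → ℕ} → (∀ i → f i ≤ g i) → sum f ≤ sum g
  sum-mono-≤ {zero}  f≤g = z≤n
  sum-mono-≤ {suc w} f≤g = ℕₚ.+-mono-≤ (f≤g Fin.zero) (sum-mono-≤ (f≤g ∘ Fin.suc))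

  sum-1 : ∀ w → sum {w} (λ _ → 1) ≡ w
  sum-1 zero    = ≡.refl
  sum-1 (suc w) = ≡.cong suc (sum-1 w)

  ∣p∣≡sum : ∀ {w} (p : Subset w) → ∣ p ∣ ≡ sum (𝟙 ∘ lookup p)
  ∣p∣≡sum []          = ≡.refl
  ∣p∣≡sum (true  ∷ p) = ≡.cong suc (∣p∣≡sum p)
  ∣p∣≡sum (false ∷ p) = ∣p∣≡sum p

  ∣tabulate∣≡sum : ∀ {w} (f : Fin w → Bool) → ∣ tabulate f ∣ ≡ sum (𝟙 ∘ f)
  ∣tabulate∣≡sum f = ≡.trans (∣p∣≡sum (tabulate f)) (sum-cong-≗ (≡.cong 𝟙 ∘ lookup∘tabulate f))

  sum-opposite : ∀ {w} (f : Fin w → ℕ) → sum (f ∘ opposite) ≡ sum f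
  sum-opposite f = ≡.sym (∑-permute f Perm.reverse)

  idx-opposite : ∀ {w} (i : Fin w) → idx (opposite i) ≡ w ∸ toℕ i
  idx-opposite i = ≡.trans (≡.cong suc (opposite-prop i)) (≡.sym (ℕₚ.+-∸-assoc 1 (toℕ<n i)))

  majority-pointwise : ∀ s g r k → (T (not s) → T (r ∨ k)) → (T (s ∧ not g) → T (r ∧ k)) →
    1 ℕ.+ 𝟙 s ≤ 2 ℕ.* 𝟙 (s ∧ g) ℕ.+ (𝟙 r ℕ.+ 𝟙 k)
  majority-pointwise false g     true  k     cover double = s≤s z≤n
  majority-pointwise false g     false true  cover double = s≤s z≤n
  majority-pointwise false g     false false cover double = ⊥-elim (cover tt)
  majority-pointwise true  true  r     k     cover double = s≤s (s≤s z≤n)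
  majority-pointwise true  false true  true  cover double = ℕₚ.≤-refl
  majority-pointwise true  false true  false cover double = ⊥-elim (double tt)
  majority-pointwise true  false false k     cover double = ⊥-elim (double tt)

  -- Double counting: an index outside s costs one charge, an index of s where g fails costs
  -- two, and r and k together hand out at most 2t < w charges.
  majority : ∀ {w t} (s g r k : Fin w → Bool) → 2 ℕ.* t < w →
    (∀ i → T (not (s i)) → T (r i ∨ k i)) → (∀ i → T (s i ∧ not (g i)) → T (r i ∧ k i)) →
    sum (𝟙 ∘ r) ≤ t → sum (𝟙 ∘ k) ≤ t → sum (𝟙 ∘ s) < 2 ℕ.* sum (λ i → 𝟙 (s i ∧ g i))
  majority {w} {t} s g r k 2t<w cover double r≤t k≤t = ℕₚ.+-cancelˡ-< w _ _ (begin-strict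
    w ℕ.+ S                                   ≡⟨ ≡.cong (ℕ._+ S) (sum-1 w) ⟨
    sum {w} (λ _ → 1) ℕ.+ S                   ≡⟨ ∑-distrib-+ (λ _ → 1) (𝟙 ∘ s) ⟨
    sum (λ i → 1 ℕ.+ 𝟙 (s i))                 ≤⟨ sum-mono-≤ pointwise ⟩
    sum (λ i → twice-good i ℕ.+ charges i)    ≡⟨ ∑-distrib-+ twice-good charges ⟩
    sum twice-good ℕ.+ sum charges            ≡⟨ ≡.cong₂ ℕ._+_ (≡.sym (*-distribˡ-sum 2 good))
                                                               (∑-distrib-+ (𝟙 ∘ r) (𝟙 ∘ k)) ⟩
    2 ℕ.* G ℕ.+ (sum (𝟙 ∘ r) ℕ.+ sum (𝟙 ∘ k)) ≤⟨ ℕₚ.+-monoʳ-≤ (2 ℕ.* G) (ℕₚ.+-mono-≤ r≤t k≤t′) ⟩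
    2 ℕ.* G ℕ.+ 2 ℕ.* t                       <⟨ ℕₚ.+-monoʳ-< (2 ℕ.* G) 2t<w ⟩
    2 ℕ.* G ℕ.+ w                             ≡⟨ ℕₚ.+-comm (2 ℕ.* G) w ⟩
    w ℕ.+ 2 ℕ.* G                             ∎)
    where
    open ℕₚ.≤-Reasoning
    good twice-good charges : Fin w → ℕ
    good i       = 𝟙 (s i ∧ g i)
    twice-good i = 2 ℕ.* good i
    charges i    = 𝟙 (r i) ℕ.+ 𝟙 (k i)
    S G : ℕ
    S = sum (𝟙 ∘ s)
    G = sum good
    pointwise : ∀ i → 1 ℕ.+ 𝟙 (s i) ≤ twice-good i ℕ.+ charges i
    pointwise i = majority-pointwise (s i) (g i) (r i) (k i) (cover i) (double i)
    k≤t′ : sum (𝟙 ∘ k) ≤ t ℕ.+ 0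
    k≤t′ = ℕₚ.≤-trans k≤t (ℕₚ.m≤m+n t 0)

module Span {c ℓ : Level} (F : FiniteField c ℓ) where
  open FiniteField F
  open Codes F
  open import Algebra.Properties.Ring ring using (-‿distribˡ-*)
  open import Algebra.Properties.CommutativeSemigroup +-commutativeSemigroup using (xy∙z≈xz∙y; interchange)
  open import Relation.Binary.Reasoning.Setoid setoid
  open import Data.List.Base using (List; []; _∷_; length; map)
  open import Data.List.Properties using (length-map)
  open import Data.List.Relation.Unary.All as All using (All; []; _∷_)
  open import Data.List.Relation.Binary.Sublist.Propositional using (_⊆_; []; _∷_; _∷ʳ_)
  open import Data.Sum.Base using (_⊎_; inj₁; inj₂)
  open import Data.Vec.Functional using (head; tail)
  open import Relation.Nullary using (yes; no; contradiction)

  data InSpan {n} : Vec n → List (Vec n) → Set (c ⊔ ℓ) where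
    []  : ∀ {v} → v ≈v 0v → InSpan v []
    _∷_ : ∀ {v u us} μ → InSpan (v +v (μ • u)) us → InSpan v (u ∷ us)

  data Free {n} : List (Vec n) → Set (c ⊔ ℓ) where
    []  : Free []
    _∷_ : ∀ {u us} → ¬ InSpan u us → Free us → Free (u ∷ us)

  InSpan-resp : ∀ {n} {u v : Vec n} {us} → u ≈v v → InSpan u us → InSpan v us
  InSpan-resp u≈v ([] u≈0)  = [] (λ i → trans (sym (u≈v i)) (u≈0 i))
  InSpan-resp u≈v (μ ∷ u∈)  = μ ∷ InSpan-resp (λ i → +-congʳ (u≈v i)) u∈

  InSpan-dim0 : ∀ (us : List (Vec 0)) v → InSpan v us
  InSpan-dim0 []       v = [] (λ ())
  InSpan-dim0 (u ∷ us) v = 0# ∷ InSpan-dim0 us _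

  +v-•-cancel : ∀ {n} (z u : Vec n) μ → ((z +v (μ • u)) +v ((- μ) • u)) ≈v z
  +v-•-cancel z u μ i = begin
    (z i + μ * u i) + - μ * u i    ≈⟨ +-congˡ (sym (-‿distribˡ-* μ (u i))) ⟩
    (z i + μ * u i) + - (μ * u i)  ≈⟨ +-assoc _ _ _ ⟩
    z i + (μ * u i + - (μ * u i))  ≈⟨ +-congˡ (-‿inverseʳ _) ⟩
    z i + 0#                       ≈⟨ +-identityʳ _ ⟩
    z i                            ∎

  HeadZero : ∀ {n} → Vec (suc n) → Set ℓ
  HeadZero v = head v ≈ 0#

  VanishesWhereEqual : ∀ {n} → Vec n → Vec n → Vec n → Set ℓ
  VanishesWhereEqual y c v = ∀ i → y i ≈ c i → v i ≈ 0#

  InSpan-tail : ∀ {n} {v : Vec (suc n)} {us} → All HeadZero us → HeadZero v →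
    InSpan (tail v) (map tail us) → InSpan v us
  InSpan-tail []                v₀≈0 ([] v≈0) = [] λ { Fin.zero → v₀≈0 ; (Fin.suc i) → v≈0 i }
  InSpan-tail {v = v} {u ∷ _} (u₀≈0 ∷ us₀≈0) v₀≈0 (μ ∷ v∈) = μ ∷ InSpan-tail us₀≈0 head≈0 v∈
    where
    head≈0 : HeadZero (v +v (μ • u))
    head≈0 = trans (+-cong v₀≈0 (trans (*-congˡ u₀≈0) (zeroʳ μ))) (+-identityʳ 0#)

  Free-tail : ∀ {n} {us : List (Vec (suc n))} → All HeadZero us → Free us → Free (map tail us)
  Free-tail []               []             = []
  Free-tail (u₀≈0 ∷ us₀≈0)  (u∉ ∷ free)  = (u∉ ∘ InSpan-tail us₀≈0 u₀≈0) ∷ Free-tail us₀≈0 free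

  -- One step of Gaussian elimination on coordinate 0.
  record Pivot {n} (y z : Vec (suc n)) (us : List (Vec (suc n))) : Set (c ⊔ ℓ) where
    field
      pivot      : Vec (suc n)
      rest       : List (Vec (suc n))
      length≡    : length us ≡ suc (length rest)
      pivot₀≉0   : ¬ HeadZero pivot
      pivot-supp : VanishesWhereEqual y z pivot
      rest₀≈0    : All HeadZero rest
      rest-free  : Free rest
      rest-supp  : All (VanishesWhereEqual y z) rest
      span⊆      : ∀ {v} μ → InSpan v rest → InSpan (v +v (μ • pivot)) us

  eliminate : ∀ {n} {y c : Vec (suc n)} (us : List (Vec (suc n))) →
    Free us → All (VanishesWhereEqual y c) us → All HeadZero us ⊎ Pivot y c us
  eliminate [] [] [] = inj₁ []
  eliminate (v ∷ vs) (v∉ ∷ free) (v-supp ∷ supp) with eliminate vs free supp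
  ... | inj₁ vs₀≈0 with head v ≟ 0#
  ...   | yes v₀≈0 = inj₁ (v₀≈0 ∷ vs₀≈0)
  ...   | no  v₀≉0 = inj₂ record
    { pivot = v ; rest = vs ; length≡ = ≡.refl ; pivot₀≉0 = v₀≉0 ; pivot-supp = v-supp
    ; rest₀≈0 = vs₀≈0 ; rest-free = free ; rest-supp = supp
    ; span⊆ = λ {z} μ z∈ → (- μ) ∷ InSpan-resp (λ i → sym (+v-•-cancel z v μ i)) z∈
    }
  eliminate {n} {y} {c} (v ∷ vs) (v∉ ∷ free) (v-supp ∷ supp) | inj₂ P = inj₂ record
    { pivot = pivot ; rest = v′ ∷ rest ; length≡ = ≡.cong suc length≡ ; pivot₀≉0 = pivot₀≉0
    ; pivot-supp = pivot-supp ; rest₀≈0 = v′₀≈0 ∷ rest₀≈0 ; rest-free = v′∉ ∷ rest-free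
    ; rest-supp = v′-supp ∷ rest-supp ; span⊆ = span⊆′
    }
    where
    open Pivot P
    q : Carrier
    q = proj₁ (inverse (head pivot) pivot₀≉0)
    κ : Carrier
    κ = - (head v * q)
    v′ : Vec (suc n)
    v′ = v +v (κ • pivot)

    q*pivot₀≈1 : q * head pivot ≈ 1#
    q*pivot₀≈1 = trans (*-comm _ _) (proj₂ (inverse (head pivot) pivot₀≉0))

    v′₀≈0 : HeadZero v′
    v′₀≈0 = begin
      head v + - (head v * q) * head pivot    ≈⟨ +-congˡ (sym (-‿distribˡ-* _ _)) ⟩
      head v + - ((head v * q) * head pivot)  ≈⟨ +-congˡ (-‿cong (*-assoc _ _ _)) ⟩
      head v + - (head v * (q * head pivot))  ≈⟨ +-congˡ (-‿cong (*-congˡ q*pivot₀≈1)) ⟩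
      head v + - (head v * 1#)                ≈⟨ +-congˡ (-‿cong (*-identityʳ _)) ⟩
      head v + - head v                       ≈⟨ -‿inverseʳ _ ⟩
      0#                                      ∎

    v′-supp : VanishesWhereEqual y c v′
    v′-supp i yᵢ≈cᵢ = trans (+-cong (v-supp i yᵢ≈cᵢ) (trans (*-congˡ (pivot-supp i yᵢ≈cᵢ)) (zeroʳ κ)))
                            (+-identityʳ 0#)

    v′∉ : ¬ InSpan v′ rest
    v′∉ v′∈ = v∉ (InSpan-resp (+v-•-cancel v pivot κ) (span⊆ (- κ) v′∈))

    span⊆′ : ∀ {z} μ → InSpan z (v′ ∷ rest) → InSpan (z +v (μ • pivot)) (v ∷ vs)
    span⊆′ {z} μ (λ₀ ∷ z∈) = λ₀ ∷ InSpan-resp regroup (span⊆ (μ + - (λ₀ * κ)) z∈)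
      where
      regroup : ((z +v (λ₀ • v′)) +v ((μ + - (λ₀ * κ)) • pivot)) ≈v ((z +v (μ • pivot)) +v (λ₀ • v))
      regroup i = begin
        (z i + λ₀ * (v i + κ * pivot i)) + (μ + - (λ₀ * κ)) * pivot i
          ≈⟨ +-cong (+-congˡ (trans (distribˡ _ _ _) (+-congˡ (sym (*-assoc _ _ _)))))
                    (trans (distribʳ _ _ _) (+-congˡ (sym (-‿distribˡ-* _ _)))) ⟩
        (z i + (λ₀ * v i + A)) + (μ * pivot i + - A)
          ≈⟨ +-congʳ (sym (+-assoc _ _ _)) ⟩
        ((z i + λ₀ * v i) + A) + (μ * pivot i + - A)
          ≈⟨ interchange _ _ _ _ ⟩
        ((z i + λ₀ * v i) + μ * pivot i) + (A + - A)
          ≈⟨ +-cong (xy∙z≈xz∙y _ _ _) (-‿inverseʳ A) ⟩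
        ((z i + μ * pivot i) + λ₀ * v i) + 0#
          ≈⟨ +-identityʳ _ ⟩
        (z i + μ * pivot i) + λ₀ * v i
          ∎
        where
        A : Carrier
        A = (λ₀ * κ) * pivot i

  VanishesWhereEqual-tail : ∀ {n} {y z : Vec (suc n)} {us} →
    All (VanishesWhereEqual y z) us → All (VanishesWhereEqual (tail y) (tail z)) (map tail us)
  VanishesWhereEqual-tail []             = []
  VanishesWhereEqual-tail (u-supp ∷ supp) = (u-supp ∘ Fin.suc) ∷ VanishesWhereEqual-tail supp

  free-length≤dist : ∀ {n} (y z : Vec n) (us : List (Vec n)) →
    Free us → All (VanishesWhereEqual y z) us → length us ≤ dist y z

  free-length≤dist-tail : ∀ {n} (y z : Vec (suc n)) (us : List (Vec (suc n))) →
    All HeadZero us → Free us → All (VanishesWhereEqual y z) us → length us ≤ dist (tail y) (tail z)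
  free-length≤dist-tail y z us us₀≈0 free supp =
    ≡.subst (_≤ dist (tail y) (tail z)) (length-map tail us)
      (free-length≤dist (tail y) (tail z) (map tail us) (Free-tail us₀≈0 free) (VanishesWhereEqual-tail supp))

  free-length≤dist {zero}  y z []       _         _    = z≤n
  free-length≤dist {zero}  y z (u ∷ us) (u∉ ∷ _) _    = contradiction (InSpan-dim0 us u) u∉
  free-length≤dist {suc n} y z us       free      supp with head y ≟ head z
  ... | yes y₀≈z₀ = free-length≤dist-tail y z us (All.map (λ u-supp → u-supp Fin.zero y₀≈z₀) supp) free supp
  ... | no  _     with eliminate us free supp
  ...   | inj₁ us₀≈0 = ℕₚ.m≤n⇒m≤1+n (free-length≤dist-tail y z us us₀≈0 free supp)
  ...   | inj₂ P     = ℕₚ.≤-trans (ℕₚ.≤-reflexive length≡)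
                         (s≤s (free-length≤dist-tail y z rest rest₀≈0 rest-free rest-supp))
    where open Pivot P

  InSpan-⊆ : ∀ {n} {v : Vec n} {us vs} → us ⊆ vs → InSpan v us → InSpan v vs
  InSpan-⊆ []                v∈       = v∈
  InSpan-⊆ {v = v} (u ∷ʳ us⊆vs) v∈    = 0# ∷ InSpan-⊆ us⊆vs (InSpan-resp v≈v+0u v∈)
    where
    v≈v+0u : v ≈v (v +v (0# • u))
    v≈v+0u i = sym (trans (+-congˡ (zeroˡ (u i))) (+-identityʳ _))
  InSpan-⊆ (≡.refl ∷ us⊆vs)  (μ ∷ v∈) = μ ∷ InSpan-⊆ us⊆vs v∈

module Rank {c ℓ : Level} (F : FiniteField c ℓ) where
  open FiniteField F
  open Codes F
  open Span F
  open import Algebra.Properties.CommutativeSemigroup +-commutativeSemigroup using (x∙yz≈xz∙y)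
  open import Relation.Binary.Reasoning.Setoid setoid
  open import Data.Bool.Base using (Bool; true; false; if_then_else_; T)
  open import Data.List.Base using (List; []; _∷_; length)
  open import Data.List.Relation.Unary.All using (All; []; _∷_)
  open import Data.List.Relation.Binary.Sublist.Propositional using (_⊆_; []; _∷_; _∷ʳ_)
  open import Data.List.Relation.Binary.Sublist.Propositional.Properties using (All-resp-⊆)
  open import Data.Unit.Base using (tt)
  open import Relation.Nullary using (does)
  open import Relation.Nullary.Decidable using (dec-true; dec-false)
  open Counting using (sum; 𝟙)

  products : ∀ {n} → (ℕ → Vec n) → Vec n → ℕ → List (Vec n)
  products g e zero    = []
  products g e (suc K) = g (suc K) ∗ e ∷ products g e K

  IndependentAt : ∀ {n} → (ℕ → Vec n) → Vec n → ℕ → Set (c ⊔ ℓ)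
  IndependentAt g e k = ∀ {v} → InShifted g k v → ¬ (v ∗ e) ≈v 0v

  _[_]≔_ : (ℕ → Carrier) → ℕ → Carrier → ℕ → Carrier
  (λs [ k ]≔ μ) m = if does (m ℕₚ.≟ k) then μ else λs m

  spanSum-cong : ∀ {n} {λs μs : ℕ → Carrier} (g : ℕ → Vec n) K →
    (∀ m → m ≤ K → λs m ≈ μs m) → spanSum λs g K ≈v spanSum μs g K
  spanSum-cong g zero    λs≈μs i = refl
  spanSum-cong g (suc K) λs≈μs i =
    +-cong (spanSum-cong g K (λ m m≤K → λs≈μs m (ℕₚ.m≤n⇒m≤1+n m≤K)) i)
           (*-congʳ (λs≈μs (suc K) ℕₚ.≤-refl))

  spanSum-≔ : ∀ {n} λs μ (g : ℕ → Vec n) K →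
    spanSum (λs [ suc K ]≔ μ) g (suc K) ≈v (spanSum λs g K +v (μ • g (suc K)))
  spanSum-≔ λs μ g K i = +-cong (spanSum-cong g K unchanged i) (*-congʳ (reflexive updated))
    where
    unchanged : ∀ m → m ≤ K → (λs [ suc K ]≔ μ) m ≈ λs m
    unchanged m m≤K rewrite dec-false (m ℕₚ.≟ suc K) (ℕₚ.<⇒≢ (s≤s m≤K)) = refl
    updated : (λs [ suc K ]≔ μ) (suc K) ≡ μ
    updated rewrite dec-true (suc K ℕₚ.≟ suc K) ≡.refl = ≡.refl

  InSpan-products : ∀ {n} (g : ℕ → Vec n) e K {z} →
    InSpan z (products g e K) → ∃[ λs ] (z +v (spanSum λs g K ∗ e)) ≈v 0v
  InSpan-products g e zero    ([] z≈0) = (λ _ → 0#) , λ i → trans (+-cong (z≈0 i) (zeroˡ (e i))) (+-identityʳ 0#)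
  InSpan-products {n} g e (suc K) {z} (μ ∷ z∈) with InSpan-products g e K z∈
  ... | λs , sum≈0 = (λs [ suc K ]≔ μ) , λ i → begin
    z i + spanSum (λs [ suc K ]≔ μ) g (suc K) i * e i  ≈⟨ +-congˡ (*-congʳ (spanSum-≔ λs μ g K i)) ⟩
    z i + (S i + μ * g (suc K) i) * e i               ≈⟨ +-congˡ (trans (distribʳ _ _ _) (+-congˡ (*-assoc _ _ _))) ⟩
    z i + (S i * e i + μ * (g (suc K) i * e i))       ≈⟨ x∙yz≈xz∙y _ _ _ ⟩
    (z i + μ * (g (suc K) i * e i)) + S i * e i       ≈⟨ sum≈0 i ⟩
    0#                                                ∎
    where
    S : Vec n
    S = spanSum λs g K

  IndependentAt⇒∉products : ∀ {n} (g : ℕ → Vec n) e K →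
    IndependentAt g e (suc K) → ¬ InSpan (g (suc K) ∗ e) (products g e K)
  IndependentAt⇒∉products g e K indep g∈ with InSpan-products g e K g∈
  ... | λs , sum≈0 = indep (λs , λ _ → refl) λ i → trans (distribʳ _ _ _) (sum≈0 i)

  VanishesWhereEqual-products : ∀ {n} (g : ℕ → Vec n) (y z : Vec n) K →
    All (VanishesWhereEqual y z) (products g (y -v z) K)
  VanishesWhereEqual-products g y z zero    = []
  VanishesWhereEqual-products g y z (suc K) = vanishes ∷ VanishesWhereEqual-products g y z K
    where
    vanishes : VanishesWhereEqual y z (g (suc K) ∗ (y -v z))
    vanishes i yᵢ≈zᵢ = trans (*-congˡ (trans (+-congʳ yᵢ≈zᵢ) (-‿inverseʳ (z i)))) (zeroʳ _)

  -- f i selects g (w ∸ toℕ i) ∗ e, so indices decrease along the list, as Free requires.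
  selected : ∀ {n w} → (ℕ → Vec n) → Vec n → (Fin w → Bool) → List (Vec n)
  selected {w = zero}  g e f = []
  selected {n} {suc w} g e f = if f Fin.zero then g (suc w) ∗ e ∷ rest else rest
    where
    rest : List (Vec n)
    rest = selected g e (f ∘ Fin.suc)

  selected⊆products : ∀ {n w} (g : ℕ → Vec n) e (f : Fin w → Bool) → selected g e f ⊆ products g e w
  selected⊆products {w = zero}  g e f = []
  selected⊆products {w = suc w} g e f with f Fin.zero
  ... | true  = ≡.refl ∷ selected⊆products g e (f ∘ Fin.suc)
  ... | false = _ ∷ʳ selected⊆products g e (f ∘ Fin.suc)

  length-selected : ∀ {n w} (g : ℕ → Vec n) e (f : Fin w → Bool) → length (selected g e f) ≡ sum (𝟙 ∘ f)
  length-selected {w = zero}  g e f = ≡.refl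
  length-selected {w = suc w} g e f with f Fin.zero
  ... | true  = ≡.cong suc (length-selected g e (f ∘ Fin.suc))
  ... | false = length-selected g e (f ∘ Fin.suc)

  Free-selected : ∀ {n w} (g : ℕ → Vec n) e (f : Fin w → Bool) →
    (∀ i → T (f i) → IndependentAt g e (w ∸ toℕ i)) → Free (selected g e f)
  Free-selected {w = zero}  g e f indep = []
  Free-selected {w = suc w} g e f indep with f Fin.zero | indep Fin.zero
  ... | true  | indep₀ =
    (IndependentAt⇒∉products g e w (indep₀ tt) ∘ InSpan-⊆ (selected⊆products g e (f ∘ Fin.suc)))
      ∷ Free-selected g e (f ∘ Fin.suc) (indep ∘ Fin.suc)
  ... | false | _      = Free-selected g e (f ∘ Fin.suc) (indep ∘ Fin.suc)

  rank-bound : ∀ {n w} (g : ℕ → Vec n) (y z : Vec n) (f : Fin w → Bool) →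
    (∀ i → T (f i) → IndependentAt g (y -v z) (w ∸ toℕ i)) → sum (𝟙 ∘ f) ≤ dist y z
  rank-bound {w = w} g y z f indep =
    ≡.subst (_≤ dist y z) (length-selected g (y -v z) f)
      (free-length≤dist y z _ (Free-selected g (y -v z) f indep)
        (All-resp-⊆ (selected⊆products g (y -v z) f) (VanishesWhereEqual-products g y z w)))

module Decoding {c ℓ : Level} (F : FiniteField c ℓ) where
  open FiniteField F
  open Codes F
  open LinearForms F
  open Rank F using (IndependentAt)
  open import Algebra.Properties.CommutativeSemigroup +-commutativeSemigroup using (x∙yz≈y∙xz)
  open import Relation.Binary.Reasoning.Setoid setoid

  module Decoder {n} (C : Code n) (w : ℕ) (a b : ℕ → Vec n) (x : Vec n)
    (orthogonal : ∀ i j → 1 ≤ i → 1 ≤ j → i ℕ.+ j ≤ w → Dual C (a i ∗ b j))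
    (diagonal : ∀ i → 1 ≤ i → i ≤ w → Dual C ((a i ∗ b (suc w ∸ i)) -v x))
    (y : Vec n) {c₀ : Vec n} (c₀∈C : C c₀)
    where

    e : Vec n
    e = y -v c₀

    ·-split : ∀ u → (u · y) ≈ (u · c₀) + (u · e)
    ·-split u = trans (cong y≈c₀+e) (additive c₀ e)
      where
      open IsLinearForm (·-linearʳ u)
      y≈c₀+e : y ≈v (c₀ +v e)
      y≈c₀+e i = sym (trans (x∙yz≈y∙xz _ _ _) (trans (+-congˡ (-‿inverseʳ (c₀ i))) (+-identityʳ (y i))))

    ·e≈0ʳ : ∀ u v → (v ∗ e) ≈v 0v → ((u ∗ v) · e) ≈ 0#
    ·e≈0ʳ u v v∗e≈0 = trans (∗·-assocʳ u v e) (trans (cong v∗e≈0) (linearForm-0v (·-linearʳ u)))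
      where open IsLinearForm (·-linearʳ u)

    ·e≈0ˡ : ∀ v u → (v ∗ e) ≈v 0v → ((v ∗ u) · e) ≈ 0#
    ·e≈0ˡ v u v∗e≈0 = trans (∗·-assocˡ v u e) (trans (cong v∗e≈0) (linearForm-0v (·-linearʳ u)))
      where open IsLinearForm (·-linearʳ u)

    orthogonal-c₀ : ∀ {i j} → 1 ≤ i → 1 ≤ j → i ℕ.+ j ≤ w → ((a i ∗ b j) · c₀) ≈ 0#
    orthogonal-c₀ 1≤i 1≤j i+j≤w = orthogonal _ _ 1≤i 1≤j i+j≤w c₀ c₀∈C

    InShifted-orthogonalˡ : ∀ {k j v} → 1 ≤ k → 1 ≤ j → k ℕ.+ j ≤ w →
      InShifted a k v → ((v ∗ b j) · c₀) ≈ 0#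
    InShifted-orthogonalˡ {k} {j} 1≤k 1≤j k+j≤w v∈ =
      trans (linearForm-InShifted (∗·-linearˡ (b j) c₀) a k orth v∈) (orthogonal-c₀ 1≤k 1≤j k+j≤w)
      where
      orth : ∀ m → 1 ≤ m → m ≤ k ∸ 1 → ((a m ∗ b j) · c₀) ≈ 0#
      orth m 1≤m m≤k-1 = orthogonal-c₀ 1≤m 1≤j
        (ℕₚ.≤-trans (ℕₚ.+-monoˡ-≤ j (ℕₚ.≤-trans m≤k-1 (ℕₚ.m∸n≤m k 1))) k+j≤w)

    InShifted-orthogonalʳ : ∀ {i l v} → 1 ≤ i → 1 ≤ l → i ℕ.+ l ≤ w →
      InShifted b l v → ((a i ∗ v) · c₀) ≈ 0#
    InShifted-orthogonalʳ {i} {l} 1≤i 1≤l i+l≤w v∈ =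
      trans (linearForm-InShifted (∗·-linearʳ (a i) c₀) b l orth v∈) (orthogonal-c₀ 1≤i 1≤l i+l≤w)
      where
      orth : ∀ m → 1 ≤ m → m ≤ l ∸ 1 → ((a i ∗ b m) · c₀) ≈ 0#
      orth m 1≤m m≤l-1 = orthogonal-c₀ 1≤i 1≤m
        (ℕₚ.≤-trans (ℕₚ.+-monoʳ-≤ i (ℕₚ.≤-trans m≤l-1 (ℕₚ.m∸n≤m l 1))) i+l≤w)

    -- Position r (0-based) pairs row suc r with column w ∸ r.
    module Position {r : ℕ} (r<w : r < w) where
      private
        column-pos : 1 ≤ w ∸ r
        column-pos = ℕₚ.m<n⇒0<n∸m r<w

        row+column≤w : ∀ {m} → m ≤ r → m ℕ.+ (w ∸ r) ≤ w
        row+column≤w m≤r =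
          ℕₚ.≤-trans (ℕₚ.+-monoˡ-≤ (w ∸ r) m≤r) (ℕₚ.≤-reflexive (ℕₚ.m+[n∸m]≡n (ℕₚ.<⇒≤ r<w)))

        below-row+≤w : ∀ {j} → j ≤ w ∸ suc r → suc r ℕ.+ j ≤ w
        below-row+≤w j≤ =
          ℕₚ.≤-trans (ℕₚ.+-monoʳ-≤ (suc r) j≤) (ℕₚ.≤-reflexive (ℕₚ.m+[n∸m]≡n r<w))

        column-1≡ : (w ∸ r) ∸ 1 ≡ w ∸ suc r
        column-1≡ = ≡.trans (ℕₚ.∸-+-assoc w r 1) (≡.cong (w ∸_) (ℕₚ.+-comm r 1))

        below-column : ∀ {j} → j ≤ (w ∸ r) ∸ 1 → j ≤ w ∸ suc r
        below-column {j} = ≡.subst (j ≤_) column-1≡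

      paired-value : ∀ {p q} → InShifted a (suc r) p → InShifted b (w ∸ r) q → ((p ∗ q) · c₀) ≈ (x · c₀)
      paired-value {p} {q} p∈ q∈ = begin
        (p ∗ q) · c₀
          ≈⟨ linearForm-InShifted (∗·-linearˡ q c₀) a (suc r) rows p∈ ⟩
        (a (suc r) ∗ q) · c₀
          ≈⟨ linearForm-InShifted (∗·-linearʳ (a (suc r)) c₀) b (w ∸ r) columns q∈ ⟩
        (a (suc r) ∗ b (w ∸ r)) · c₀
          ≈⟨ ·-≈-by-difference c₀ (diagonal (suc r) (s≤s z≤n) r<w c₀ c₀∈C) ⟩
        x · c₀
          ∎
        where
        rows : ∀ m → 1 ≤ m → m ≤ r → ((a m ∗ q) · c₀) ≈ 0#
        rows m 1≤m m≤r = InShifted-orthogonalʳ 1≤m column-pos (row+column≤w m≤r) q∈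
        columns : ∀ j → 1 ≤ j → j ≤ (w ∸ r) ∸ 1 → ((a (suc r) ∗ b j) · c₀) ≈ 0#
        columns j 1≤j j≤ = orthogonal-c₀ (s≤s z≤n) 1≤j (below-row+≤w (below-column j≤))

      paired-value-at-y : ∀ {p q} → InShifted a (suc r) p → InShifted b (w ∸ r) q →
        ((p ∗ q) · e) ≈ 0# → ((p ∗ q) · y) ≈ (x · c₀)
      paired-value-at-y {p} {q} p∈ q∈ [p∗q]·e≈0 = begin
        (p ∗ q) · y                       ≈⟨ ·-split (p ∗ q) ⟩
        ((p ∗ q) · c₀) + ((p ∗ q) · e)    ≈⟨ +-cong (paired-value p∈ q∈) [p∗q]·e≈0 ⟩
        (x · c₀) + 0#                     ≈⟨ +-identityʳ _ ⟩
        x · c₀                            ∎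

      ∉I⇒row-independent : ¬ InI w a b y (suc r) → IndependentAt a e (suc r)
      ∉I⇒row-independent ∉I {v} v∈ v∗e≈0 = ∉I (v , v∈ , vanishes)
        where
        vanishes : ∀ j → 1 ≤ j → j ≤ w ∸ suc r → ((v ∗ b j) · y) ≈ 0#
        vanishes j 1≤j j≤ = begin
          (v ∗ b j) · y                       ≈⟨ ·-split (v ∗ b j) ⟩
          ((v ∗ b j) · c₀) + ((v ∗ b j) · e)  ≈⟨ +-cong (InShifted-orthogonalˡ (s≤s z≤n) 1≤j (below-row+≤w j≤) v∈)
                                                        (·e≈0ˡ v (b j) v∗e≈0) ⟩
          0# + 0#                             ≈⟨ +-identityʳ 0# ⟩
          0#                                  ∎

      ∉I*⇒column-independent : ¬ InI* w a b y (suc r) → IndependentAt b e (w ∸ r)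
      ∉I*⇒column-independent ∉I* {v} v∈ v∗e≈0 = ∉I* (v , v∈ , vanishes)
        where
        vanishes : ∀ m → 1 ≤ m → m ≤ r → ((a m ∗ v) · y) ≈ 0#
        vanishes m 1≤m m≤r = begin
          (a m ∗ v) · y                       ≈⟨ ·-split (a m ∗ v) ⟩
          ((a m ∗ v) · c₀) + ((a m ∗ v) · e)  ≈⟨ +-cong (InShifted-orthogonalʳ 1≤m column-pos (row+column≤w m≤r) v∈)
                                                        (·e≈0ʳ (a m) v v∗e≈0) ⟩
          0# + 0#                             ≈⟨ +-identityʳ 0# ⟩
          0#                                  ∎

      module _ {a′ b′ : Vec n} (a′∈I : WitnessI w a b y (suc r) a′) (b′∈I* : WitnessI* w a b y (suc r) b′)
               (wrong : ¬ (x · c₀) ≈ ((a′ ∗ b′) · y)) where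

        misdecoded⇒row-independent : IndependentAt a e (suc r)
        misdecoded⇒row-independent {v} v∈ v∗e≈0 = wrong (begin
          x · c₀         ≈⟨ paired-value-at-y v∈ (proj₁ b′∈I*) (·e≈0ˡ v b′ v∗e≈0) ⟨
          (v ∗ b′) · y   ≈⟨ linearForm-constant-on-InShifted (∗·-linearˡ b′ y) a (suc r)
                                (proj₂ b′∈I*) v∈ (proj₁ a′∈I) ⟩
          (a′ ∗ b′) · y  ∎)

        misdecoded⇒column-independent : IndependentAt b e (w ∸ r)
        misdecoded⇒column-independent {v} v∈ v∗e≈0 = wrong (begin
          x · c₀         ≈⟨ paired-value-at-y (proj₁ a′∈I) v∈ (·e≈0ʳ a′ v v∗e≈0) ⟨
          (a′ ∗ v) · y   ≈⟨ linearForm-constant-on-InShifted (∗·-linearʳ a′ y) b (w ∸ r)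
                                columns v∈ (proj₁ b′∈I*) ⟩
          (a′ ∗ b′) · y  ∎)
          where
          columns : ∀ j → 1 ≤ j → j ≤ (w ∸ r) ∸ 1 → ((a′ ∗ b j) · y) ≈ 0#
          columns j 1≤j j≤ = proj₂ a′∈I j 1≤j (below-column j≤)

open import Relation.Nullary using (Dec; yes; no)
open import Relation.Nullary.Decidable
  using (¬¬-excluded-middle; isYes; True; T?; ¬?; _⊎-dec_; _×-dec_; toWitness; toWitnessFalse; fromWitness;
         decidable-stable)
open import Data.Fin.Properties using (∀-cons; toℕ<n)
open import Data.Fin.Subset using (Subset; _∈_; _∉_; _⊆_; ∣_∣)
open import Data.Vec.Base using (tabulate; lookup)
open import Data.Vec.Properties using (lookup∘tabulate; lookup⇒[]=; []=⇒lookup)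
open import Data.Bool.Base using (Bool; T; not; _∧_; _∨_)
open import Data.Bool.Properties using (T-≡; T-∧; T-∨; T-not-≡)
open import Data.Sum.Base using (_⊎_; inj₁; inj₂)
open import Function.Bundles using (_⇔_; Equivalence)

¬¬-decide-all : ∀ {p w} (P : Fin w → Set p) → ¬ ¬ (∀ i → Dec (P i))
¬¬-decide-all {w = zero}  P ¬dec = ¬dec (λ ())
¬¬-decide-all {w = suc w} P ¬dec =
  ¬¬-excluded-middle λ P₀? → ¬¬-decide-all (P ∘ Fin.suc) λ P₊? → ¬dec (∀-cons P₀? P₊?)

module MajorityDecoding {c ℓ : Level} (F : FiniteField c ℓ) where
  open FiniteField F
  open Codes F
  open Rank F using (IndependentAt; rank-bound)
  open Decoding F
  open Counting

  module Vote {n} (C : Code n) (w : ℕ) (a b : ℕ → Vec n) (x : Vec n)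
    (orthogonal : ∀ i j → 1 ≤ i → 1 ≤ j → i ℕ.+ j ≤ w → Dual C (a i ∗ b j))
    (diagonal : ∀ i → 1 ≤ i → i ≤ w → Dual C ((a i ∗ b (suc w ∸ i)) -v x))
    {t : ℕ} (2t<w : 2 ℕ.* t < w) (y : Vec n) (S : Subset w)
    (S⇔I∩I* : ∀ i → (i ∈ S) ⇔ (InI w a b y (idx i) × InI* w a b y (idx i)))
    (a′ b′ : Fin w → Vec n)
    (witnesses : ∀ i → i ∈ S → WitnessI w a b y (idx i) (a′ i) × WitnessI* w a b y (idx i) (b′ i))
    {c₀ : Vec n} (c₀∈C : C c₀) (dist≤t : dist y c₀ ≤ t)
    where

    open Decoder C w a b x orthogonal diagonal y c₀∈C using (e; module Position)

    correct? : ∀ i → Dec ((x · c₀) ≈ ((a′ i ∗ b′ i) · y))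
    correct? i = (x · c₀) ≟ ((a′ i ∗ b′ i) · y)

    Correct : Subset w
    Correct = tabulate (λ i → lookup S i ∧ isYes (correct? i))

    ∈Correct : ∀ {i} → i ∈ Correct → T (lookup S i) × True (correct? i)
    ∈Correct {i} i∈ = Equivalence.to T-∧ (Equivalence.from T-≡
      (≡.trans (≡.sym (lookup∘tabulate _ i)) ([]=⇒lookup i∈)))

    T-lookup⇒∈ : ∀ {i} → T (lookup S i) → i ∈ S
    T-lookup⇒∈ {i} h = lookup⇒[]= i S (Equivalence.to T-≡ h)

    Correct⊆S : Correct ⊆ S
    Correct⊆S = T-lookup⇒∈ ∘ proj₁ ∘ ∈Correct

    Correct-correct : ∀ i → i ∈ Correct → (x · c₀) ≈ ((a′ i ∗ b′ i) · y)
    Correct-correct i = toWitness ∘ proj₂ ∘ ∈Correct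

    module Charging (I? : ∀ (i : Fin w) → Dec (InI w a b y (idx i)))
                    (I*? : ∀ (i : Fin w) → Dec (InI* w a b y (idx i))) where

      Misdecoded : Fin w → Set ℓ
      Misdecoded i = T (lookup S i) × ¬ (x · c₀) ≈ ((a′ i ∗ b′ i) · y)

      row-charged? : ∀ i → Dec (¬ InI w a b y (idx i) ⊎ Misdecoded i)
      row-charged? i = ¬? (I? i) ⊎-dec (T? (lookup S i) ×-dec ¬? (correct? i))

      column-charged? : ∀ i → Dec (¬ InI* w a b y (idx i) ⊎ Misdecoded i)
      column-charged? i = ¬? (I*? i) ⊎-dec (T? (lookup S i) ×-dec ¬? (correct? i))

      row-independent : ∀ i → ¬ InI w a b y (idx i) ⊎ Misdecoded i → IndependentAt a e (idx i)
      row-independent i (inj₁ ∉I)            = Position.∉I⇒row-independent (toℕ<n i) ∉I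
      row-independent i (inj₂ (i∈S , wrong)) =
        Position.misdecoded⇒row-independent (toℕ<n i) (proj₁ witness) (proj₂ witness) wrong
        where
        witness : WitnessI w a b y (idx i) (a′ i) × WitnessI* w a b y (idx i) (b′ i)
        witness = witnesses i (T-lookup⇒∈ i∈S)

      column-independent : ∀ i → ¬ InI* w a b y (idx i) ⊎ Misdecoded i → IndependentAt b e (w ∸ toℕ i)
      column-independent i (inj₁ ∉I*)           = Position.∉I*⇒column-independent (toℕ<n i) ∉I*
      column-independent i (inj₂ (i∈S , wrong)) =
        Position.misdecoded⇒column-independent (toℕ<n i) (proj₁ witness) (proj₂ witness) wrong
        where
        witness : WitnessI w a b y (idx i) (a′ i) × WitnessI* w a b y (idx i) (b′ i)
        witness = witnesses i (T-lookup⇒∈ i∈S)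

      rows : Fin w → Bool
      rows = isYes ∘ row-charged?

      columns : Fin w → Bool
      columns = isYes ∘ column-charged?

      few-rows : sum (𝟙 ∘ rows) ≤ t
      few-rows = begin
        sum (𝟙 ∘ rows)             ≡⟨ sum-opposite (𝟙 ∘ rows) ⟨
        sum (𝟙 ∘ rows ∘ opposite)  ≤⟨ rank-bound a y c₀ (rows ∘ opposite) indep ⟩
        dist y c₀                  ≤⟨ dist≤t ⟩
        t                          ∎
        where
        open ℕₚ.≤-Reasoning
        indep : ∀ i → T (rows (opposite i)) → IndependentAt a e (w ∸ toℕ i)
        indep i h = ≡.subst (IndependentAt a e) (idx-opposite i) (row-independent (opposite i) (toWitness h))

      few-columns : sum (𝟙 ∘ columns) ≤ t
      few-columns = ℕₚ.≤-trans (rank-bound b y c₀ columns (λ i h → column-independent i (toWitness h))) dist≤t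

      outside-S-charged : ∀ i → T (not (lookup S i)) → T (rows i ∨ columns i)
      outside-S-charged i i∉S = Equivalence.from (T-∨ {rows i} {columns i}) (charge (I? i))
        where
        ∉S : i ∉ S
        ∉S i∈S with () ← ≡.trans (≡.sym ([]=⇒lookup i∈S)) (Equivalence.to T-not-≡ i∉S)
        charge : Dec (InI w a b y (idx i)) → T (rows i) ⊎ T (columns i)
        charge (yes I) = inj₂ (fromWitness {a? = column-charged? i}
                                (inj₁ (λ I* → ∉S (Equivalence.from (S⇔I∩I* i) (I , I*)))))
        charge (no ∉I) = inj₁ (fromWitness {a? = row-charged? i} (inj₁ ∉I))

      misdecoded-charged-twice : ∀ i → T (lookup S i ∧ not (isYes (correct? i))) → T (rows i ∧ columns i)
      misdecoded-charged-twice i h = Equivalence.from (T-∧ {rows i} {columns i})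
        (fromWitness {a? = row-charged? i} (inj₂ misdecoded) , fromWitness {a? = column-charged? i} (inj₂ misdecoded))
        where
        i∈S×wrong : T (lookup S i) × T (not (isYes (correct? i)))
        i∈S×wrong = Equivalence.to (T-∧ {lookup S i} {not (isYes (correct? i))}) h
        misdecoded : Misdecoded i
        misdecoded = proj₁ i∈S×wrong , toWitnessFalse {a? = correct? i} (proj₂ i∈S×wrong)

      charged-majority : ∣ S ∣ < 2 ℕ.* ∣ Correct ∣
      charged-majority = ≡.subst₂ (λ s g → s < 2 ℕ.* g)
        (≡.sym (∣p∣≡sum S)) (≡.sym (∣tabulate∣≡sum (λ i → lookup S i ∧ isYes (correct? i))))
        (majority (lookup S) (isYes ∘ correct?) rows columns 2t<w
          outside-S-charged misdecoded-charged-twice few-rows few-columns)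

    S-majority : ∣ S ∣ < 2 ℕ.* ∣ Correct ∣
    S-majority = decidable-stable (∣ S ∣ ℕₚ.<? 2 ℕ.* ∣ Correct ∣) λ ¬majority →
      ¬¬-decide-all _ λ I? → ¬¬-decide-all _ λ I*? → ¬majority (Charging.charged-majority I? I*?)

open import Data.Nat.Base using (_+_; _*_)

theoremA1 : ∀ {c ℓ : Level} (F : FiniteField c ℓ) → let open Codes F in
  ∀ (n : ℕ) (C C₁ : Code n) →
  IsLinearCode C → IsLinearCode C₁ → C₁ ⊆C C → QuotientDim1 C C₁ →
  ∀ (w : ℕ) (a b : ℕ → Vec n) (x : Vec n) →
  (∀ i j → 1 ≤ i → 1 ≤ j → i + j ≤ w → Dual C (a i ∗ b j)) →
  (∀ i j → 1 ≤ i → 1 ≤ j → i + j ≡ suc w → Dual C₁ (a i ∗ b j) × ¬ Dual C (a i ∗ b j)) →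
  Dual C₁ x → ¬ Dual C x →
  (∀ i → 1 ≤ i → i ≤ w → Dual C ((a i ∗ b (suc w ∸ i)) -v x)) →
  ∀ (t : ℕ) → 2 * t < w →
  ∀ (y : Vec n) → (∃[ c₀ ] (C c₀ × dist y c₀ ≤ t)) →
  ∀ (S : Subset w) →
  (∀ i → (i ∈ S) ⇔ (InI w a b y (idx i) × InI* w a b y (idx i))) →
  ∀ (a' b' : Fin w → Vec n) →
  (∀ i → i ∈ S → WitnessI w a b y (idx i) (a' i) × WitnessI* w a b y (idx i) (b' i)) →
  ∀ (c₀ : Vec n) → C c₀ → dist y c₀ ≤ t →
  ∃[ T ] (T ⊆ S × (∀ i → i ∈ T → (x · c₀) ≈F ((a' i ∗ b' i) · y)) × ∣ S ∣ < 2 * ∣ T ∣)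
theoremA1 F _ C _ _ _ _ _ w a b x orthogonal _ _ _ diagonal _ 2t<w y _ S S⇔I∩I* a′ b′ witnesses
          c₀ c₀∈C dist≤t =
  Correct , Correct⊆S , Correct-correct , S-majority
  where
  open MajorityDecoding.Vote F C w a b x orthogonal diagonal 2t<w y S S⇔I∩I* a′ b′ witnesses c₀∈C dist≤t
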